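{- Let $H$ be a finite group and let $G=H\times\langle a\rangle$ with $\langle a\rangle\cong\mathbb{Z}_2$. For every connected non-bipartite Cayley graph $\mathrm{Cay}(H,S)$ the following are equivalent: (1) $\mathrm{Cay}(H,S)$ is unstable; (2) there exists a Schurian S-ring $\mathcal{A}$ over $G$ such that $\underline{H}\in\mathcal{A}$, $\underline{Sa}\in\mathcal{A}$ and $\underline{\{a\}}\notin\mathcal{A}$, where $Sa=\{sa: s\in S\}$.
   Context: All groups and graphs are finite; graphs are simple. For a group $H$ and $S\subseteq H$ with $1_H\notin S$ and $S=S^{ -1}$, the Cayley graph $\mathrm{Cay}(H,S)$ has vertex set $H$ and edges $\{x,sx\}$ for $x\in H$, $s\in S$. For a graph $\Gamma$, the direct product $\Gamma\times K_2$ has vertex set $V(\Gamma)\times\{0,1\}$ and edges $\{(u,0),(v,1)\}$ for $\{u,v\}\in E(\Gamma)$. $\Gamma$ is stable if $\mathrm{Aut}(\Gamma\times K_2)\cong\mathrm{Aut}(\Gamma)\times\mathbb{Z}_2$, and unstable otherwise. For $X\subseteq G$, $\underline{X}=\sum_{x\in X}x\in\mathbb{Z}G$. An S-ring (Schur ring) over $G$ is a subring $\mathcal{A}$ of the integer group ring $\mathbb{Z}G$ for which there is a partition $\mathcal{S}(\mathcal{A})$ of $G$ (the basic sets) such that $\{1_G\}\in\mathcal{S}(\mathcal{A})$, $X^{ -1}\in\mathcal{S}(\mathcal{A})$ whenever $X\in\mathcal{S}(\mathcal{A})$, and $\mathcal{A}$ is the $\mathbb{Z}$-span of $\{\underline{X}:X\in\mathcal{S}(\mathcal{A})\}$.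 For $g\in G$ let $g_r$ be the permutation $x\mapsto xg$ and $G_r=\{g_r:g\in G\}$. An S-ring $\mathcal{A}$ over $G$ is Schurian if there is a permutation group $B\le\mathrm{Sym}(G)$ with $G_r\le B$ such that $\mathcal{A}$ is the $\mathbb{Z}$-span of $\{\underline{X}: X \text{ an orbit of the stabiliser } B_{1_G} \text{ on } G\}$. -}

module Defs where

open import Level using (0ℓ)
open import Data.Nat using (ℕ; _≡ᵇ_)
open import Data.Fin using (Fin)
open import Data.Fin.Properties using (_≟_)
open import Data.Bool using (Bool; true; false; _xor_; not; _∧_)
open import Data.Product using (Σ; ∃; ∃-syntax; _×_; _,_; proj₁; proj₂)
open import Data.List using (List; []; _∷_; length; filterᵇ; allFin; cartesianProduct)
open import Function.Bundles using (Inverse; _↔_; _⇔_)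
open import Function.Construct.Composition using (_↔-∘_; _⇔-∘_)
open import Relation.Binary.PropositionalEquality using (_≡_; _≢_)
open import Relation.Nullary using (¬_)
open import Relation.Nullary.Decidable using (⌊_⌋)

-- Finite groups: a group of order n, realised on the carrier Fin n
-- (every finite group is isomorphic to one of this form).

record FinGroup (n : ℕ) : Set where
  field
    _·_   : Fin n → Fin n → Fin n
    e     : Fin n
    inv   : Fin n → Fin n
    assoc : ∀ x y z → (x · y) · z ≡ x · (y · z)
    idˡ   : ∀ x → e · x ≡ x
    idʳ   : ∀ x → x · e ≡ x
    invˡ  : ∀ x → inv x · x ≡ e
    invʳ  : ∀ x → x · inv x ≡ e

record Graph : Set₁ where
  field
    V   : Set
    Adj : V → V → Set

open Graph public

Cay : ∀ {n} → FinGroup n → (Fin n → Bool) → Graph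
Cay {n} H S = record { V = Fin n ; Adj = λ x y → S (y · inv x) ≡ true }
  where open FinGroup H

_×K₂ : Graph → Graph
Γ ×K₂ = record { V = V Γ × Bool
               ; Adj = λ p q → Adj Γ (proj₁ p) (proj₁ q) × proj₂ q ≡ not (proj₂ p) }

data Reach (Γ : Graph) : V Γ → V Γ → Set where
  here : ∀ {u} → Reach Γ u u
  step : ∀ {u v w} → Adj Γ u v → Reach Γ v w → Reach Γ u w

Connected : Graph → Set
Connected Γ = ∀ u v → Reach Γ u v

Bipartite : Graph → Set
Bipartite Γ = Σ (V Γ → Bool) λ c → (∀ u v → Adj Γ u v → c u ≢ c v)

record Aut (Γ : Graph) : Set where
  field
    perm : V Γ ↔ V Γ
    pres : ∀ u v → Adj Γ u v ⇔ Adj Γ (Inverse.to perm u) (Inverse.to perm v)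

open Aut public

_≈A_ : ∀ {Γ} → Aut Γ → Aut Γ → Set
f ≈A g = ∀ v → Inverse.to (perm f) v ≡ Inverse.to (perm g) v

_∘A_ : ∀ {Γ} → Aut Γ → Aut Γ → Aut Γ
f ∘A g = record
  { perm = perm f ↔-∘ perm g
  ; pres = λ u v → pres f (Inverse.to (perm g) u) (Inverse.to (perm g) v) ⇔-∘ pres g u v }

_≈P_ : ∀ {Γ} → Aut Γ × Bool → Aut Γ × Bool → Set
(f , b) ≈P (g , c) = f ≈A g × b ≡ c

_⊙_ : ∀ {Γ} → Aut Γ × Bool → Aut Γ × Bool → Aut Γ × Bool
(f , b) ⊙ (g , c) = (f ∘A g , b xor c)

record AutIso (Γ : Graph) : Set where
  field
    φ    : Aut (Γ ×K₂) → Aut Γ × Bool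
    φ-cong : ∀ f g → f ≈A g → φ f ≈P φ g
    φ-hom  : ∀ f g → φ (f ∘A g) ≈P (φ f ⊙ φ g)
    φ-inj  : ∀ f g → φ f ≈P φ g → f ≈A g
    φ-surj : ∀ y → ∃[ f ] (φ f ≈P y)

Stable : Graph → Set
Stable Γ = AutIso Γ

Unstable : Graph → Set
Unstable Γ = ¬ Stable Γ

-- The group G = H × ⟨a⟩, ⟨a⟩ ≅ Z₂, realised on Fin n × Bool; a = (e , true)

module _ {n : ℕ} (H : FinGroup n) where
  open FinGroup H

  GEl : Set
  GEl = Fin n × Bool

  _·G_ : GEl → GEl → GEl
  (x , b) ·G (y , c) = (x · y , b xor c)

  invG : GEl → GEl
  invG (x , b) = (inv x , b)

  1G : GEl
  1G = (e , false)

  elemsG : List GEl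
  elemsG = cartesianProduct (allFin n) (false ∷ true ∷ [])

  -- S-rings over G are encoded by their partition into basic sets, given as
  -- the fibres of a labelling κ : G → ℕ.  The Z-span of the basic-set sums
  -- contains 1 and is an additive group; it is a subring iff, for all basic
  -- sets X, Y, the coefficient of g in X̲·Y̲ is constant on basic sets.
  -- coeff κ u v g = coefficient of g in X̲·Y̲, X, Y the basic sets of u, v.
  coeff : (GEl → ℕ) → GEl → GEl → GEl → ℕ
  coeff κ u v g =
    length (filterᵇ (λ x → (κ x ≡ᵇ κ u) ∧ (κ (invG x ·G g) ≡ᵇ κ v)) elemsG)

  record IsSRing (κ : GEl → ℕ) : Set where
    field
      unit-basic : ∀ g → κ g ≡ κ 1G → g ≡ 1G
      inv-basic  : ∀ g g' → κ g ≡ κ g' → κ (invG g) ≡ κ (invG g')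
      mul-closed : ∀ u v g g' → κ g ≡ κ g' → coeff κ u v g ≡ coeff κ u v g'

  -- X̲ ∈ A (for X ⊆ G) iff X is a union of basic sets
  InA : (GEl → ℕ) → (GEl → Bool) → Set
  InA κ X = ∀ g g' → κ g ≡ κ g' → X g ≡ X g'

  -- Schurian: the basic sets are the orbits of B_{1_G} for some permutation
  -- group B ≤ Sym(G) containing G_r.  B is given by a membership predicate on
  -- permutations, closed (up to pointwise equality) under identity,
  -- composition and inverses.
  record Schurian (κ : GEl → ℕ) : Set₁ where
    field
      B      : (GEl ↔ GEl) → Set
      B-id   : ∃[ b ] (B b × (∀ x → Inverse.to b x ≡ x))
      B-comp : ∀ b c → B b → B c →
               ∃[ d ] (B d × (∀ x → Inverse.to d x ≡ Inverse.to b (Inverse.to c x)))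
      B-inv  : ∀ b → B b → ∃[ d ] (B d × (∀ x → Inverse.to d x ≡ Inverse.from b x))
      B-right : ∀ g → ∃[ b ] (B b × (∀ x → Inverse.to b x ≡ x ·G g))
      orbits : ∀ x y → (κ x ≡ κ y) ⇔
               (∃[ b ] (B b × Inverse.to b 1G ≡ 1G × Inverse.to b x ≡ y))

  Hset : GEl → Bool
  Hset (x , b) = not b

  Sa : (Fin n → Bool) → GEl → Bool
  Sa S (x , b) = b ∧ S x

  aset : GEl → Bool
  aset (x , b) = b ∧ ⌊ x ≟ e ⌋

-- Write G = H × ⟨a⟩ and Γ₂ = Cay(H, S) × K₂.  Then Γ₂ = Cay(G, Sa), so the right
-- translations of G act on Γ₂.  Pairs (σ, t) ∈ Aut Γ × Z₂ lift to automorphisms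
-- (x, β) ↦ (σ x, β + t) of Γ₂, injectively; as everything is finite, Γ is stable
-- exactly when every automorphism of Γ₂ is such a lift.
--
-- (1 ⇒ 2) Take B = Aut Γ₂ and let A be spanned by the orbits of the stabiliser of 1.
-- Because Γ is connected and not bipartite, an automorphism of Γ₂ shifts the layer
-- of every vertex by the same amount, so H is a union of orbits; so is Sa, the
-- neighbourhood of 1.  If {a} were an orbit, conjugating by right
-- translations would make every automorphism commute with multiplication by a,
-- i.e. be a lift, and Γ would be stable.
--
-- (2 ⇒ 1) If A is Schurian with group B and Sa ∈ A, then every b ∈ B satisfies
-- b(v) b(u)⁻¹ ∈ Sa ⇔ v u⁻¹ ∈ Sa, i.e. is an automorphism of Γ₂.  If moreover
-- {a} ∉ A, some b fixes 1 but moves a, and such an automorphism is not a lift.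

module Submission where

open import Defs
open import Level using (0ℓ)
open import Algebra.Bundles using (Group)
open import Algebra.Structures using (IsGroup)
import Algebra.Properties.Group as GroupProperties
open import Data.Bool using (Bool; true; false; _xor_; not; _∧_; T)
open import Data.Bool.Properties
  using (T?; xor-assoc; xor-comm; xor-identityʳ; xor-same; not-distribˡ-xor; xor-annihilates-not)
  renaming (_≟_ to _≟ᵇ_)
open import Data.Fin using (Fin; zero; suc; toℕ; combine; funToFin; finToFun)
open import Data.Fin.Properties
  using (any?; all?; combine-injective; finToFun-funToFin; toℕ-injective; 2↔Bool; *↔×; pigeonhole; injective⇒≤)
  renaming (_≟_ to _≟ᶠ_)
open import Data.List using (List; []; _∷_; length; lookup; map; filterᵇ)
open import Data.List.Properties using (length-map)
open import Data.List.Membership.Propositional using (_∈_)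
open import Data.List.Membership.Propositional.Properties
  using (∈-lookup; ∈-allFin; ∈-cartesianProduct⁺; ∈-map⁻; ∈-filter⁺; ∈-filter⁻)
open import Data.List.Relation.Binary.Subset.Propositional using (_⊆_)
open import Data.List.Relation.Unary.All as All using ([]; _∷_)
open import Data.List.Relation.Unary.AllPairs using ([]; _∷_)
open import Data.List.Relation.Unary.Any using (index; here; there)
open import Data.List.Relation.Unary.Any.Properties using (lookup-index)
open import Data.List.Relation.Unary.Unique.Propositional using (Unique)
import Data.List.Relation.Unary.Unique.Propositional.Properties as Unique
open import Data.Nat using (ℕ; zero; suc; _*_; _^_; _<_; _≤_; s≤s; _≡ᵇ_)
open import Data.Nat.Properties using (n<1+n; ≤-antisym)
open import Data.Product using (∃; ∃-syntax; _×_; _,_; proj₁; proj₂)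
open import Data.Product.Function.NonDependent.Propositional using (_×-⇔_; _×-↔_)
open import Function using (_∘_)
open import Function.Bundles using (Inverse; Injection; _↔_; _⇔_; mk⇔; mk↔ₛ′; Equivalence)
open import Function.Construct.Composition using (_⇔-∘_)
open import Function.Construct.Symmetry using (⇔-sym)
open import Function.Properties.Inverse using (↔-refl; ↔-sym; ↔-trans; ↔⇒↣; to-from)
open import Relation.Binary.Core using (Rel)
open import Relation.Binary.Structures using (IsEquivalence; IsDecEquivalence)
open import Relation.Binary.PropositionalEquality
  using (_≡_; _≢_; refl; sym; trans; cong; cong₂; subst; subst₂; isEquivalence; module ≡-Reasoning)
open import Relation.Nullary using (¬_; Dec; yes; no; contradiction)
open import Relation.Nullary.Decidable
  using (map′; via-injection; decidable-stable; _×-dec_; _→-dec_; does; does-⇔; dec-true; proof)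
open import Relation.Nullary.Reflects using (Reflects; invert)
open import Relation.Unary using (Decidable)

open Inverse using (to; from; strictlyInverseˡ; strictlyInverseʳ)
open Equivalence using () renaming (to to ⇒; from to ⇐)

↔-injective : ∀ {A B : Set} (b : A ↔ B) {x y} → to b x ≡ to b y → x ≡ y
↔-injective b = Injection.injective (↔⇒↣ b)

xor-involutiveʳ : ∀ t b → (b xor t) xor t ≡ b
xor-involutiveʳ t b = trans (xor-assoc b t t) (trans (cong (b xor_) (xor-same t)) (xor-identityʳ b))

≡not⇔xor : ∀ t β γ → (γ ≡ not β) ⇔ (γ xor t ≡ not (β xor t))
≡not⇔xor t β γ = mk⇔
  (λ γ≡¬β → trans (cong (_xor t) γ≡¬β) (sym (not-distribˡ-xor β t)))
  (λ eq → trans (sym (xor-involutiveʳ t γ))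
         (trans (cong (_xor t) (trans eq (not-distribˡ-xor β t))) (xor-involutiveʳ t (not β))))

xor≡true⇔≡not : ∀ γ β → (γ xor β ≡ true) ⇔ (γ ≡ not β)
xor≡true⇔≡not true  β     = mk⇔ sym sym
xor≡true⇔≡not false true  = mk⇔ (λ _ → refl) (λ _ → refl)
xor≡true⇔≡not false false = mk⇔ (λ ()) (λ ())

∧≡true⇔ : ∀ {b c} → (b ∧ c ≡ true) ⇔ (b ≡ true × c ≡ true)
∧≡true⇔ {true}  = mk⇔ (refl ,_) proj₂
∧≡true⇔ {false} = mk⇔ (λ ()) (λ ())

≡true-injective : ∀ {b c} → (b ≡ true ⇔ c ≡ true) → b ≡ c
≡true-injective {true}  b⇔c = sym (⇒ b⇔c refl)
≡true-injective {false} {true} b⇔c = ⇐ b⇔c refl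
≡true-injective {false} {false} b⇔c = refl

funToFin-cong : ∀ {m n} {f g : Fin m → Fin n} → (∀ i → f i ≡ g i) → funToFin f ≡ funToFin g
funToFin-cong {zero} _ = refl
funToFin-cong {suc m} f≗g = cong₂ combine (f≗g zero) (funToFin-cong (f≗g ∘ suc))

fromBool : Bool → Fin 2
fromBool = Inverse.from 2↔Bool

fromBool-injective : ∀ {a b} → fromBool a ≡ fromBool b → a ≡ b
fromBool-injective = ↔-injective (↔-sym 2↔Bool)

module Enumerated {A : Set} {m : ℕ} (enum : A ↔ Fin m) where
  open Inverse enum using () renaming (to to code; from to element; strictlyInverseʳ to element-code)

  _≟_ : (x y : A) → Dec (x ≡ y)
  _≟_ = via-injection (↔⇒↣ enum) _≟ᶠ_

  ∃? : {P : A → Set} → Decidable P → Dec (∃ P)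
  ∃? {P} P? = map′ (λ (i , p) → element i , p) (λ (x , p) → code x , subst P (sym (element-code x)) p)
               (any? (P? ∘ element))

  ∀? : {P : A → Set} → Decidable P → Dec (∀ x → P x)
  ∀? {P} P? = map′ (λ h x → subst P (element-code x) (h (code x))) (λ h → h ∘ element) (all? (P? ∘ element))

  endomap : Fin (m ^ m) → A → A
  endomap i = element ∘ finToFun i ∘ code

  endomap-funToFin : (f : A → A) → ∀ x → endomap (funToFin (code ∘ f ∘ element)) x ≡ f x
  endomap-funToFin f x = trans (cong element (finToFun-funToFin (code ∘ f ∘ element) (code x)))
                              (trans (element-code _) (cong f (element-code x)))

  ∃?-endo : {P : (A → A) → Set} → (∀ {f g} → (∀ x → f x ≡ g x) → P f → P g) →
            Decidable P → Dec (∃ P)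
  ∃?-endo resp P? = map′ (λ (i , p) → endomap i , p)
                         (λ (f , p) → funToFin (code ∘ f ∘ element) , resp (λ x → sym (endomap-funToFin f x)) p)
                         (any? (P? ∘ endomap))

  module _ {ℓ} {_∼_ : Rel A ℓ} (isDecEquivalence : IsDecEquivalence _∼_) where
    open IsDecEquivalence isDecEquivalence
      using () renaming (_≟_ to _∼?_; reflexive to ∼-reflexive; sym to ∼-sym; trans to ∼-trans)

    -- The class of x is labelled by its characteristic function, read as a number.
    classCode : A → Fin (2 ^ m)
    classCode x = funToFin (λ i → fromBool (does (element i ∼? x)))

    classIndex : A → ℕ
    classIndex x = toℕ (classCode x)

    classCode-≡⇒does-≡ : ∀ {x y} → classCode x ≡ classCode y →
                         ∀ i → does (element i ∼? x) ≡ does (element i ∼? y)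
    classCode-≡⇒does-≡ {x} {y} eq i = fromBool-injective (begin
      fromBool (does (element i ∼? x))  ≡⟨ finToFun-funToFin _ i ⟨
      finToFun (classCode x) i          ≡⟨ cong (λ c → finToFun c i) eq ⟩
      finToFun (classCode y) i          ≡⟨ finToFun-funToFin _ i ⟩
      fromBool (does (element i ∼? y))  ∎)
      where open ≡-Reasoning

    classIndex-≡⇔ : ∀ x y → classIndex x ≡ classIndex y ⇔ x ∼ y
    classIndex-≡⇔ x y = mk⇔ sound complete
      where
      sound : classIndex x ≡ classIndex y → x ∼ y
      sound eq = ∼-trans (∼-reflexive (sym (element-code x)))
                         (invert (subst (Reflects _) (sym x̂∼y) (proof (element (code x) ∼? y))))
        where
        x̂∼y : true ≡ does (element (code x) ∼? y)
        x̂∼y = trans (sym (dec-true (element (code x) ∼? x) (∼-reflexive (element-code x))))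
                    (classCode-≡⇒does-≡ (toℕ-injective eq) (code x))
      complete : x ∼ y → classIndex x ≡ classIndex y
      complete x∼y = cong toℕ (funToFin-cong λ i → cong fromBool
        (does-⇔ (mk⇔ (λ p → ∼-trans p x∼y) (λ p → ∼-trans p (∼-sym x∼y)))
                (element i ∼? x) (element i ∼? y)))

module _ {A : Set} {ℓ} (_≈_ : Rel A ℓ) {m : ℕ} (code : A → Fin m)
         (code-injective : ∀ x y → code x ≡ code y → x ≈ y) where

  injective⇒¬¬surjective : (ψ : A → A) → (∀ x y → ψ x ≈ ψ y → x ≈ y) →
                           ∀ z → ¬ (∀ y → ¬ z ≈ ψ y)
  injective⇒¬¬surjective ψ ψ-injective z z∉image =
    let i , j , i<j , eq = pigeonhole (n<1+n m) (λ i → code (iterate (toℕ i)))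
    in iterates-distinct (toℕ i) (toℕ j) i<j (code-injective _ _ eq)
    where
    iterate : ℕ → A
    iterate zero = z
    iterate (suc k) = ψ (iterate k)

    iterates-distinct : ∀ i j → i < j → ¬ iterate i ≈ iterate j
    iterates-distinct zero (suc j) _ = z∉image (iterate j)
    iterates-distinct (suc i) (suc j) (s≤s i<j) = iterates-distinct i j i<j ∘ ψ-injective _ _

module _ {A : Set} where

  Unique⇒lookup-injective : ∀ {xs : List A} → Unique xs → ∀ {i j} → lookup xs i ≡ lookup xs j → i ≡ j
  Unique⇒lookup-injective (x∉xs ∷ u) {zero}  {zero}  _  = refl
  Unique⇒lookup-injective (x∉xs ∷ u) {zero}  {suc j} eq = contradiction eq (All.lookup x∉xs (∈-lookup j))
  Unique⇒lookup-injective (x∉xs ∷ u) {suc i} {zero}  eq = contradiction (sym eq) (All.lookup x∉xs (∈-lookup i))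
  Unique⇒lookup-injective (x∉xs ∷ u) {suc i} {suc j} eq = cong suc (Unique⇒lookup-injective u eq)

  Unique-⊆⇒length≤ : ∀ {xs ys : List A} → Unique xs → xs ⊆ ys → length xs ≤ length ys
  Unique-⊆⇒length≤ {xs} {ys} u xs⊆ys = injective⇒≤ λ {i} {j} eq → Unique⇒lookup-injective u (begin
    lookup xs i             ≡⟨ lookup-index (position i) ⟩
    lookup ys (index (position i)) ≡⟨ cong (lookup ys) eq ⟩
    lookup ys (index (position j)) ≡⟨ lookup-index (position j) ⟨
    lookup xs j             ∎)
    where
    open ≡-Reasoning
    position : ∀ i → lookup xs i ∈ ys
    position i = xs⊆ys (∈-lookup i)

  length-filterᵇ-≤ : ∀ {xs : List A} → Unique xs → (∀ x → x ∈ xs) →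
                     (p q : A → Bool) (β : A → A) → (∀ {x y} → β x ≡ β y → x ≡ y) →
                     (∀ x → p x ≡ q (β x)) → length (filterᵇ p xs) ≤ length (filterᵇ q xs)
  length-filterᵇ-≤ {xs} unique complete p q β β-injective p≡q∘β =
    subst (_≤ length (filterᵇ q xs)) (length-map β (filterᵇ p xs))
      (Unique-⊆⇒length≤ (Unique.map⁺ β-injective (Unique.filter⁺ (T? ∘ p) unique)) image⊆)
    where
    image⊆ : map β (filterᵇ p xs) ⊆ filterᵇ q xs
    image⊆ y∈ with ∈-map⁻ β y∈
    ... | x , x∈ , refl = ∈-filter⁺ (T? ∘ q) (complete (β x))
                            (subst T (p≡q∘β x) (proj₂ (∈-filter⁻ (T? ∘ p) {xs = xs} x∈)))

module _ {a ℓ} (𝔾 : Group a ℓ) where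
  open Group 𝔾 using (_≈_; _∙_; _⁻¹; _//_; _\\_; assoc; ∙-congˡ; ∙-congʳ; setoid)
  open GroupProperties 𝔾
    using (⁻¹-anti-homo-∙; ⁻¹-anti-homo-//; ⁻¹-anti-homo-\\; //-rightDividesˡ; \\-leftDividesˡ)
  open import Relation.Binary.Reasoning.Setoid setoid

  [x//y]\\x≈y : ∀ x y → (x // y) \\ x ≈ y
  [x//y]\\x≈y x y = begin
    (x // y) \\ x  ≈⟨ ∙-congʳ (⁻¹-anti-homo-// x y) ⟩
    (y // x) ∙ x   ≈⟨ //-rightDividesˡ x y ⟩
    y              ∎

  x//[y\\x]≈y : ∀ x y → x // (y \\ x) ≈ y
  x//[y\\x]≈y x y = begin
    x // (y \\ x)  ≈⟨ ∙-congˡ (⁻¹-anti-homo-\\ y x) ⟩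
    x ∙ (x \\ y)   ≈⟨ \\-leftDividesˡ x y ⟩
    y              ∎

  [x∙z]//[y∙z]≈x//y : ∀ x y z → (x ∙ z) // (y ∙ z) ≈ x // y
  [x∙z]//[y∙z]≈x//y x y z = begin
    (x ∙ z) // (y ∙ z)      ≈⟨ ∙-congˡ (⁻¹-anti-homo-∙ y z) ⟩
    (x ∙ z) ∙ (z \\ y ⁻¹)   ≈⟨ assoc x z (z \\ y ⁻¹) ⟩
    x ∙ (z ∙ (z \\ y ⁻¹))   ≈⟨ ∙-congˡ (\\-leftDividesˡ z (y ⁻¹)) ⟩
    x // y                  ∎

-- Automorphisms of Γ × K₂

module _ {Γ : Graph} where

  IsAutomorphism : (V Γ ↔ V Γ) → Set
  IsAutomorphism b = ∀ u v → Adj Γ u v ⇔ Adj Γ (to b u) (to b v)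

  idAut : Aut Γ
  idAut = record { perm = ↔-refl ; pres = λ u v → mk⇔ (λ a → a) (λ a → a) }

  _⁻¹A : Aut Γ → Aut Γ
  F ⁻¹A = record
    { perm = ↔-sym (perm F)
    ; pres = λ u v → ⇔-sym (subst₂ (λ u′ v′ → Adj Γ (from (perm F) u) (from (perm F) v) ⇔ Adj Γ u′ v′)
                                   (strictlyInverseˡ (perm F) u) (strictlyInverseˡ (perm F) v) (pres F _ _)) }

  reach-preserves : (P : V Γ → Set) → (∀ {u v} → Adj Γ u v → P u → P v) →
                    ∀ {u v} → Reach Γ u v → P u → P v
  reach-preserves P adj⇒ here         pu = pu
  reach-preserves P adj⇒ (step uv vw) pu = reach-preserves P adj⇒ vw (adj⇒ uv pu)

module _ {Γ : Graph} (connected : Connected Γ) (¬bipartite : ¬ Bipartite Γ)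
         (t : V Γ × Bool → V Γ × Bool)
         (t-adj : ∀ u v → Adj (Γ ×K₂) u v → Adj (Γ ×K₂) (t u) (t v)) where

  layerShift : V Γ × Bool → Bool
  layerShift v = proj₂ (t v) xor proj₂ v

  layerShift-edge : ∀ u v → Adj (Γ ×K₂) u v → layerShift u ≡ layerShift v
  layerShift-edge u v uv@(_ , v≡¬u) with t-adj u v uv
  ... | _ , tv≡¬tu rewrite v≡¬u | tv≡¬tu = sym (xor-annihilates-not (proj₂ (t u)) (proj₂ u))

  -- Otherwise x ↦ layerShift (x , false) would properly 2-colour Γ.
  layerShift-fibre : ∀ x → layerShift (x , false) ≡ layerShift (x , true)
  layerShift-fibre x with layerShift (x , false) ≟ᵇ layerShift (x , true)
  ... | yes eq = eq
  ... | no  ne = contradiction (colour , proper) ¬bipartite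
    where
    Split : V Γ → Set
    Split y = layerShift (y , false) ≢ layerShift (y , true)
    split-step : ∀ {y z} → Adj Γ y z → Split y → Split z
    split-step yz split-y eq = split-y (trans (layerShift-edge _ _ (yz , refl))
                                      (trans (sym eq) (sym (layerShift-edge _ _ (yz , refl)))))
    colour : V Γ → Bool
    colour y = layerShift (y , false)
    proper : ∀ y z → Adj Γ y z → colour y ≢ colour z
    proper y z yz eq = reach-preserves Split split-step (connected x z) ne
                         (trans (sym eq) (layerShift-edge _ _ (yz , refl)))

  layerShift-constant : ∀ u v → layerShift u ≡ layerShift v
  layerShift-constant (x , β) (y , γ) = trans (onLayer β) (trans (base-constant (connected x y)) (sym (onLayer γ)))
    where
    onLayer : ∀ {z} β → layerShift (z , β) ≡ layerShift (z , false)
    onLayer false = refl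
    onLayer true = sym (layerShift-fibre _)
    base-constant : ∀ {y} → Reach Γ x y → layerShift (x , false) ≡ layerShift (y , false)
    base-constant xy = reach-preserves (λ z → layerShift (x , false) ≡ layerShift (z , false))
      (λ zw eq → trans eq (trans (layerShift-edge _ _ (zw , refl)) (sym (layerShift-fibre _)))) xy refl

  layer-formula : ∀ u v → proj₂ (t u) ≡ proj₂ u xor proj₂ (t (v , false))
  layer-formula u@(_ , β) v = begin
    proj₂ (t u)                              ≡⟨ xor-involutiveʳ β _ ⟨
    (proj₂ (t u) xor β) xor β                ≡⟨ cong (_xor β) (layerShift-constant u (v , false)) ⟩
    (proj₂ (t (v , false)) xor false) xor β  ≡⟨ cong (_xor β) (xor-identityʳ (proj₂ (t (v , false)))) ⟩
    proj₂ (t (v , false)) xor β              ≡⟨ xor-comm _ β ⟩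
    β xor proj₂ (t (v , false))              ∎
    where open ≡-Reasoning

module _ {Γ : Graph} where

  lift : Aut Γ × Bool → Aut (Γ ×K₂)
  lift (σ , t) = record
    { perm = mk↔ₛ′ (λ (x , β) → to (perm σ) x , β xor t) (λ (y , γ) → from (perm σ) y , γ xor t)
                   (λ (y , γ) → cong₂ _,_ (strictlyInverseˡ (perm σ) y) (xor-involutiveʳ t γ))
                   (λ (x , β) → cong₂ _,_ (strictlyInverseʳ (perm σ) x) (xor-involutiveʳ t β))
    ; pres = λ (x , β) (y , γ) → pres σ x y ×-⇔ ≡not⇔xor t β γ }

  lift-fixes-fibre : ∀ y {v} → to (perm (lift y)) (v , false) ≡ (v , false) →
                     to (perm (lift y)) (v , true) ≡ (v , true)
  lift-fixes-fibre y eq = cong₂ _,_ (cong proj₁ eq) (cong not (cong proj₂ eq))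

  module _ (v₀ : V Γ) where

    lift-injective : ∀ y y′ → lift y ≈A lift y′ → y ≈P y′
    lift-injective y y′ eq = (λ x → cong proj₁ (eq (x , false))) , cong proj₂ (eq (v₀ , false))

    base : Aut (Γ ×K₂) → V Γ → V Γ
    base F x = proj₁ (to (perm F) (x , false))

    shift : Aut (Γ ×K₂) → Bool
    shift F = proj₂ (to (perm F) (v₀ , false))

    IsLift : Aut (Γ ×K₂) → Set
    IsLift F = ∀ x β → to (perm F) (x , β) ≡ (base F x , β xor shift F)

    module _ (F : Aut (Γ ×K₂)) (isLift : IsLift F) where

      baseAut : Aut Γ
      baseAut = record
        { perm = mk↔ₛ′ (base F) (λ y → proj₁ (from (perm F) (y , shift F)))
                   (λ y → cong proj₁ (trans (sym (isLift _ _)) (strictlyInverseˡ (perm F) (y , shift F))))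
                   (λ x → cong proj₁ (trans (cong (from (perm F)) (sym (isLift x false)))
                                            (strictlyInverseʳ (perm F) (x , false))))
        ; pres = λ x y → mk⇔
            (λ xy → proj₁ (subst₂ (Adj (Γ ×K₂)) (isLift x false) (isLift y true) (⇒ (pres F _ _) (xy , refl))))
            (λ xy → proj₁ (⇐ (pres F _ _)
                             (subst₂ (Adj (Γ ×K₂)) (sym (isLift x false)) (sym (isLift y true)) (xy , refl)))) }

    every-IsLift⇒stable : (∀ F → IsLift F) → Stable Γ
    every-IsLift⇒stable isLift = record
      { φ = φ
      ; φ-cong = λ F G F≈G → (λ x → cong proj₁ (F≈G (x , false))) , cong proj₂ (F≈G (v₀ , false))
      ; φ-hom = λ F G → (λ x → cong proj₁ (composite F G x)) ,
                         trans (cong proj₂ (composite F G v₀)) (xor-comm (shift G) (shift F))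
      ; φ-inj = λ F G (base≈ , shift≡) (x , β) → trans (isLift F x β)
          (trans (cong₂ _,_ (base≈ x) (cong (β xor_) shift≡)) (sym (isLift G x β)))
      ; φ-surj = λ y → lift y , (λ _ → refl) , refl }
      where
      φ : Aut (Γ ×K₂) → Aut Γ × Bool
      φ F = baseAut F (isLift F) , shift F
      composite : ∀ F G x → to (perm (F ∘A G)) (x , false) ≡ (base F (base G x) , shift G xor shift F)
      composite F G x = trans (cong (to (perm F)) (isLift G x false)) (isLift F _ _)

module StabiliserOrbits (Γ : Graph) (o : V Γ) where

  _∼_ : V Γ → V Γ → Set
  x ∼ y = ∃[ b ] (IsAutomorphism {Γ} b × to b o ≡ o × to b x ≡ y)

  ∼-isEquivalence : IsEquivalence _∼_
  ∼-isEquivalence = record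
    { refl  = perm (idAut {Γ}) , pres (idAut {Γ}) , refl , refl
    ; sym   = λ (b , Bb , bo≡o , bx≡y) → let F = record { perm = b ; pres = Bb } ⁻¹A in
                perm F , pres F , to-from b bo≡o , to-from b bx≡y
    ; trans = λ (b , Bb , bo≡o , bx≡y) (c , Bc , co≡o , cy≡z) →
                let F = record { perm = c ; pres = Bc } ∘A record { perm = b ; pres = Bb } in
                perm F , pres F , trans (cong (to c) bo≡o) co≡o , trans (cong (to c) bx≡y) cy≡z }

  module _ {m : ℕ} (enum : V Γ ↔ Fin m) (adj? : ∀ u v → Dec (Adj Γ u v)) where
    open Enumerated enum

    -- _∼_ restated in terms of plain functions, which ∃?-endo can search.
    Witness : V Γ → V Γ → (V Γ → V Γ) → Set
    Witness x y t = (∀ u v → t u ≡ t v → u ≡ v) × (∀ w → ∃ λ u → t u ≡ w)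
                  × (∀ u v → (Adj Γ u v → Adj Γ (t u) (t v)) × (Adj Γ (t u) (t v) → Adj Γ u v))
                  × t o ≡ o × t x ≡ y

    witness? : ∀ x y t → Dec (Witness x y t)
    witness? x y t =
      ∀? (λ u → ∀? λ v → (t u ≟ t v) →-dec (u ≟ v)) ×-dec
      ∀? (λ w → ∃? λ u → t u ≟ w) ×-dec
      ∀? (λ u → ∀? λ v → (adj? u v →-dec adj? (t u) (t v)) ×-dec (adj? (t u) (t v) →-dec adj? u v)) ×-dec
      (t o ≟ o) ×-dec (t x ≟ y)

    witness-cong : ∀ {x y t t′} → (∀ u → t u ≡ t′ u) → Witness x y t → Witness x y t′
    witness-cong {x} t≗t′ (injective , surjective , preserves , to≡o , tx≡y) =
      (λ u v eq → injective u v (trans (t≗t′ u) (trans eq (sym (t≗t′ v))))) ,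
      (λ w → let u , tu≡w = surjective w in u , trans (sym (t≗t′ u)) tu≡w) ,
      (λ u v → (λ uv → subst₂ (Adj Γ) (t≗t′ u) (t≗t′ v) (proj₁ (preserves u v) uv)) ,
               (λ tuv → proj₂ (preserves u v) (subst₂ (Adj Γ) (sym (t≗t′ u)) (sym (t≗t′ v)) tuv))) ,
      trans (sym (t≗t′ o)) to≡o , trans (sym (t≗t′ x)) tx≡y

    ∼⇔∃Witness : ∀ x y → x ∼ y ⇔ ∃ (Witness x y)
    ∼⇔∃Witness x y = mk⇔
      (λ (b , Bb , bo≡o , bx≡y) → to b ,
         (λ u v → ↔-injective b) , (λ w → from b w , strictlyInverseˡ b w) ,
         (λ u v → ⇒ (Bb u v) , ⇐ (Bb u v)) , bo≡o , bx≡y)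
      (λ (t , injective , surjective , preserves , to≡o , tx≡y) →
         mk↔ₛ′ t (proj₁ ∘ surjective) (proj₂ ∘ surjective)
               (λ u → injective _ u (proj₂ (surjective (t u)))) ,
         (λ u v → mk⇔ (proj₁ (preserves u v)) (proj₂ (preserves u v))) , to≡o , tx≡y)

    ∼-isDecEquivalence : IsDecEquivalence _∼_
    ∼-isDecEquivalence = record
      { isEquivalence = ∼-isEquivalence
      ; _≟_ = λ x y → map′ (⇐ (∼⇔∃Witness x y)) (⇒ (∼⇔∃Witness x y))
                            (∃?-endo witness-cong (witness? x y)) }

-- Schurian S-rings over G = H × ⟨a⟩

module _ {n : ℕ} (H : FinGroup n) where
  open FinGroup H

  ·G-isGroup : IsGroup _≡_ (_·G_ H) (1G H) (invG H)
  ·G-isGroup = record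
    { isMonoid = record
      { isSemigroup = record
        { isMagma = record { isEquivalence = isEquivalence ; ∙-cong = cong₂ (_·G_ H) }
        ; assoc = λ (x , β) (y , γ) (z , δ) → cong₂ _,_ (assoc x y z) (xor-assoc β γ δ) }
      ; identity = (λ (x , β) → cong (_, β) (idˡ x))
                 , (λ (x , β) → cong₂ _,_ (idʳ x) (xor-identityʳ β)) }
    ; inverse = (λ (x , β) → cong₂ _,_ (invˡ x) (xor-same β))
              , (λ (x , β) → cong₂ _,_ (invʳ x) (xor-same β))
    ; ⁻¹-cong = cong (invG H) }

  groupG : Group 0ℓ 0ℓ
  groupG = record { isGroup = ·G-isGroup }

  elemsG-complete : ∀ g → g ∈ elemsG H
  elemsG-complete (x , β) = ∈-cartesianProduct⁺ (∈-allFin x) (Bool∈ β)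
    where
    Bool∈ : ∀ β → β ∈ false ∷ true ∷ []
    Bool∈ false = here refl
    Bool∈ true  = there (here refl)

  elemsG-unique : Unique (elemsG H)
  elemsG-unique = Unique.cartesianProduct⁺ (Unique.allFin⁺ n) (((λ ()) ∷ []) ∷ [] ∷ [])

  enumG : GEl H ↔ Fin (n * 2)
  enumG = ↔-trans (↔-refl ×-↔ ↔-sym 2↔Bool) (↔-sym *↔×)

  a : GEl H
  a = FinGroup.e H , true

  aset≡true⇔≡a : ∀ g → aset H g ≡ true ⇔ g ≡ a
  aset≡true⇔≡a (x , false) = mk⇔ (λ ()) (λ ())
  aset≡true⇔≡a (x , true) with x ≟ᶠ FinGroup.e H
  ... | yes refl = mk⇔ (λ _ → refl) (λ _ → refl)
  ... | no  x≢e  = mk⇔ (λ ()) (λ g≡a → contradiction (cong proj₁ g≡a) x≢e)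

module SchurianRing {n : ℕ} (H : FinGroup n) {κ : GEl H → ℕ} (schurian : Schurian H κ) where
  open Schurian schurian
  open Group (groupG H) using (_∙_; ε; _⁻¹; _//_; _\\_; identityˡ; inverseʳ)
  open GroupProperties (groupG H) using (//-rightDividesˡ)

  conjugate : ∀ b → B b → ∀ p → ∃[ d ] (B d × to d ε ≡ ε × ∀ z → to d z ≡ to b (z ∙ p) // to b p)
  conjugate b Bb p with B-right p
  ... | r , Br , r≗ with B-comp b r Bb Br
  ... | c , Bc , c≗ with B-right (to b p ⁻¹)
  ... | r′ , Br′ , r′≗ with B-comp r′ c Br′ Bc
  ... | d , Bd , d≗ = d , Bd , dε≡ε , d≗′
    where
    d≗′ : ∀ z → to d z ≡ to b (z ∙ p) // to b p
    d≗′ z = trans (d≗ z) (trans (r′≗ _) (cong (_// to b p) (trans (c≗ z) (cong (to b) (r≗ z)))))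
    dε≡ε : to d ε ≡ ε
    dε≡ε = trans (d≗′ ε) (trans (cong (λ z → to b z // to b p) (identityˡ p)) (inverseʳ (to b p)))

  κ-invariant : ∀ {b} → B b → to b ε ≡ ε → ∀ x → κ (to b x) ≡ κ x
  κ-invariant Bb bε≡ε x = sym (⇐ (orbits x _) (_ , Bb , bε≡ε , refl))

  κ-//-invariant : ∀ {b} → B b → ∀ p q → κ (to b q // to b p) ≡ κ (q // p)
  κ-//-invariant {b} Bb p q with conjugate b Bb p
  ... | d , Bd , dε≡ε , d≗ = begin
    κ (to b q // to b p)               ≡⟨ cong (λ z → κ (to b z // to b p)) (//-rightDividesˡ p q) ⟨
    κ (to b ((q // p) ∙ p) // to b p)  ≡⟨ cong κ (d≗ (q // p)) ⟨
    κ (to d (q // p))                  ≡⟨ κ-invariant Bd dε≡ε (q // p) ⟩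
    κ (q // p)                         ∎
    where open ≡-Reasoning

  coeff-≤ : ∀ u v g g′ → κ g ≡ κ g′ → coeff H κ u v g ≤ coeff H κ u v g′
  coeff-≤ u v g g′ κg≡κg′ with ⇒ (orbits g g′) κg≡κg′
  ... | b , Bb , bε≡ε , bg≡g′ =
    length-filterᵇ-≤ (elemsG-unique H) (elemsG-complete H) _ _ β β-injective λ x →
      cong₂ (λ k l → (k ≡ᵇ κ u) ∧ (l ≡ᵇ κ v)) (sym (κ∘β x)) (sym (κ[β\\g′] x))
    where
    β : GEl H → GEl H
    β x = g′ // to b (x \\ g)
    κ[β\\g′] : ∀ x → κ (β x \\ g′) ≡ κ (x \\ g)
    κ[β\\g′] x = trans (cong κ ([x//y]\\x≈y (groupG H) g′ _)) (κ-invariant Bb bε≡ε (x \\ g))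
    κ∘β : ∀ x → κ (β x) ≡ κ x
    κ∘β x = begin
      κ (g′ // to b (x \\ g))    ≡⟨ cong (λ h → κ (h // to b (x \\ g))) bg≡g′ ⟨
      κ (to b g // to b (x \\ g)) ≡⟨ κ-//-invariant Bb (x \\ g) g ⟩
      κ (g // (x \\ g))           ≡⟨ cong κ (x//[y\\x]≈y (groupG H) g x) ⟩
      κ x                         ∎
      where open ≡-Reasoning
    β-injective : ∀ {x y} → β x ≡ β y → x ≡ y
    β-injective {x} {y} βx≡βy = begin
      x                    ≡⟨ x//[y\\x]≈y (groupG H) g x ⟨
      g // (x \\ g)        ≡⟨ cong (g //_) (↔-injective b (begin
        to b (x \\ g)        ≡⟨ [x//y]\\x≈y (groupG H) g′ _ ⟨
        β x \\ g′            ≡⟨ cong (_\\ g′) βx≡βy ⟩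
        β y \\ g′            ≡⟨ [x//y]\\x≈y (groupG H) g′ _ ⟩
        to b (y \\ g)        ∎)) ⟩
      g // (y \\ g)        ≡⟨ x//[y\\x]≈y (groupG H) g y ⟩
      y                    ∎
      where open ≡-Reasoning

  isSRing : IsSRing H κ
  isSRing = record
    { unit-basic = λ g κg≡κε → let b , _ , bε≡ε , bg≡ε = ⇒ (orbits g ε) κg≡κε in
                                ↔-injective b (trans bg≡ε (sym bε≡ε))
    ; inv-basic  = λ g g′ κg≡κg′ → let b , Bb , bε≡ε , bg≡g′ = ⇒ (orbits g g′) κg≡κg′ in begin
        κ (g ⁻¹)                ≡⟨ cong κ (identityˡ (g ⁻¹)) ⟨
        κ (ε // g)              ≡⟨ κ-//-invariant Bb g ε ⟨
        κ (to b ε // to b g)    ≡⟨ cong₂ (λ x y → κ (x // y)) bε≡ε bg≡g′ ⟩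
        κ (ε // g′)             ≡⟨ cong κ (identityˡ (g′ ⁻¹)) ⟩
        κ (g′ ⁻¹)               ∎
    ; mul-closed = λ u v g g′ κg≡κg′ →
                     ≤-antisym (coeff-≤ u v g g′ κg≡κg′) (coeff-≤ u v g′ g (sym κg≡κg′)) }
    where open ≡-Reasoning

  StabiliserFixes : GEl H → Set
  StabiliserFixes g = ∀ b → B b → to b ε ≡ ε → to b g ≡ g

  aset∈A⇔stabiliser-fixes-a : InA H κ (aset H) ⇔ StabiliserFixes (a H)
  aset∈A⇔stabiliser-fixes-a = mk⇔
    (λ aset∈A b Bb bε≡ε → ⇒ (aset≡true⇔≡a H _)
       (trans (aset∈A _ _ (κ-invariant Bb bε≡ε (a H))) (⇐ (aset≡true⇔≡a H (a H)) refl)))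
    (λ fixes g g′ κg≡κg′ → ≡true-injective
       (mk⇔ (orbit-preserves-a fixes κg≡κg′) (orbit-preserves-a fixes (sym κg≡κg′))))
    where
    orbit-preserves-a : StabiliserFixes (a H) → ∀ {g g′} → κ g ≡ κ g′ →
                        aset H g ≡ true → aset H g′ ≡ true
    orbit-preserves-a fixes {g} {g′} κg≡κg′ g∈ with ⇒ (orbits g g′) κg≡κg′ | ⇒ (aset≡true⇔≡a H g) g∈
    ... | b , Bb , bε≡ε , bg≡g′ | refl = ⇐ (aset≡true⇔≡a H g′) (trans (sym bg≡g′) (fixes b Bb bε≡ε))

module CayleyDoubleCover {n : ℕ} (H : FinGroup n) (S : Fin n → Bool) where
  open Group (groupG H) using (_∙_; ε; _⁻¹; _//_; identityʳ)
  open GroupProperties (groupG H) using (ε⁻¹≈ε; //-rightDividesˡ; //-rightDividesʳ)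

  Γ₂ : Graph
  Γ₂ = Cay H S ×K₂

  adj⇔Sa : ∀ u v → Adj Γ₂ u v ⇔ (Sa H S (v // u) ≡ true)
  adj⇔Sa (x , β) (y , γ) = mk⇔
    (λ (s , γ≡¬β) → ⇐ ∧≡true⇔ (⇐ (xor≡true⇔≡not γ β) γ≡¬β , s))
    (λ Sa≡true → let γ⊕β , s = ⇒ ∧≡true⇔ Sa≡true in s , ⇒ (xor≡true⇔≡not γ β) γ⊕β)

  Sa-≡⇒adj⇔ : ∀ {u v u′ v′} → Sa H S (v // u) ≡ Sa H S (v′ // u′) → Adj Γ₂ u v ⇔ Adj Γ₂ u′ v′
  Sa-≡⇒adj⇔ {u} {v} {u′} {v′} eq = mk⇔
    (λ uv → ⇐ (adj⇔Sa u′ v′) (trans (sym eq) (⇒ (adj⇔Sa u v) uv)))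
    (λ uv′ → ⇐ (adj⇔Sa u v) (trans eq (⇒ (adj⇔Sa u′ v′) uv′)))

  ε-adj⇔Sa : ∀ g → Adj Γ₂ ε g ⇔ (Sa H S g ≡ true)
  ε-adj⇔Sa g = subst (λ h → Adj Γ₂ ε g ⇔ (Sa H S h ≡ true)) g//ε≡g (adj⇔Sa ε g)
    where
    g//ε≡g : g // ε ≡ g
    g//ε≡g = trans (cong (g ∙_) ε⁻¹≈ε) (identityʳ g)

  rightTranslation : GEl H → Aut Γ₂
  rightTranslation g = record
    { perm = mk↔ₛ′ (_∙ g) (_// g) (//-rightDividesˡ g) (//-rightDividesʳ g)
    ; pres = λ u v → Sa-≡⇒adj⇔ (cong (Sa H S) (sym ([x∙z]//[y∙z]≈x//y (groupG H) v u g))) }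

  autCode : Aut (Cay H S) × Bool → Fin (n ^ n * 2)
  autCode (σ , t) = combine (funToFin (to (perm σ))) (fromBool t)

  autCode-injective : ∀ y y′ → autCode y ≡ autCode y′ → y ≈P y′
  autCode-injective (σ , t) (σ′ , t′) eq with combine-injective _ _ _ _ eq
  ... | σ≡σ′ , t≡t′ = (λ x → trans (sym (finToFun-funToFin _ x))
                                (trans (cong (λ c → finToFun c x) σ≡σ′) (finToFun-funToFin _ x))) ,
                       fromBool-injective t≡t′

  adj? : ∀ u v → Dec (Adj Γ₂ u v)
  adj? u v = map′ (⇐ (adj⇔Sa u v)) (⇒ (adj⇔Sa u v)) (Sa H S (v // u) ≟ᵇ true)

  module _ {κ : GEl H → ℕ} (schurian : Schurian H κ) (Sa∈A : InA H κ (Sa H S)) where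
    open Schurian schurian using (B)
    open SchurianRing H schurian using (κ-//-invariant)

    schurian⇒isAutomorphism : ∀ {b} → B b → IsAutomorphism {Γ₂} b
    schurian⇒isAutomorphism Bb u v = Sa-≡⇒adj⇔ (Sa∈A _ _ (sym (κ-//-invariant Bb u v)))

module _ {n : ℕ} (H : FinGroup n) (S : Fin n → Bool)
         {κ : GEl H → ℕ} (schurian : Schurian H κ) (Sa∈A : InA H κ (Sa H S)) where
  open CayleyDoubleCover H S
  open SchurianRing H schurian using (StabiliserFixes; aset∈A⇔stabiliser-fixes-a)
  open Enumerated (enumG H) using (_≟_)
  open Group (groupG H) using (ε)

  -- b would give an automorphism of Γ₂ outside the image of φ ∘ lift, an injective
  -- self-map of the finite set Aut Γ × Z₂.
  stable⇒stabiliser-fixes-a : Stable (Cay H S) → StabiliserFixes (a H)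
  stable⇒stabiliser-fixes-a stable b Bb bε≡ε = decidable-stable (to b (a H) ≟ a H) λ ba≢a →
    injective⇒¬¬surjective _≈P_ autCode autCode-injective ψ ψ-injective (φ F) λ y φF≈ψy →
      let F≈lift = φ-inj F (lift y) φF≈ψy in
      ba≢a (trans (F≈lift (a H)) (lift-fixes-fibre y (trans (sym (F≈lift ε)) bε≡ε)))
    where
    open AutIso stable
    F : Aut Γ₂
    F = record { perm = b ; pres = schurian⇒isAutomorphism schurian Sa∈A Bb }
    ψ : Aut (Cay H S) × Bool → Aut (Cay H S) × Bool
    ψ = φ ∘ lift
    ψ-injective : ∀ y y′ → ψ y ≈P ψ y′ → y ≈P y′
    ψ-injective y y′ ψy≈ψy′ = lift-injective (FinGroup.e H) y y′ (φ-inj (lift y) (lift y′) ψy≈ψy′)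

  schurian⇒unstable : ¬ InA H κ (aset H) → Unstable (Cay H S)
  schurian⇒unstable a∉A stable = a∉A (⇐ aset∈A⇔stabiliser-fixes-a (stable⇒stabiliser-fixes-a stable))

module _ {n : ℕ} (H : FinGroup n) (S : Fin n → Bool)
         (connected : Connected (Cay H S)) (¬bipartite : ¬ Bipartite (Cay H S)) where
  open CayleyDoubleCover H S
  open FinGroup H using (e; idˡ; _·_)
  open Group (groupG H) using (_∙_; ε; _//_)
  open GroupProperties (groupG H) using (//-rightDividesˡ)
  open StabiliserOrbits Γ₂ ε using (_∼_; ∼-isDecEquivalence)
  open Enumerated (enumG H) using (classIndex; classIndex-≡⇔)

  orbit-isDecEquivalence : IsDecEquivalence _∼_
  orbit-isDecEquivalence = ∼-isDecEquivalence (enumG H) adj?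

  orbitIndex : GEl H → ℕ
  orbitIndex = classIndex orbit-isDecEquivalence

  orbitIndex-schurian : Schurian H orbitIndex
  orbitIndex-schurian = record
    { B       = IsAutomorphism {Γ₂}
    ; B-id    = perm (idAut {Γ₂}) , pres (idAut {Γ₂}) , λ _ → refl
    ; B-comp  = λ b c Bb Bc → let F = record { perm = b ; pres = Bb } ∘A record { perm = c ; pres = Bc } in
                  perm F , pres F , λ _ → refl
    ; B-inv   = λ b Bb → let F = record { perm = b ; pres = Bb } ⁻¹A in perm F , pres F , λ _ → refl
    ; B-right = λ g → perm (rightTranslation g) , pres (rightTranslation g) , λ _ → refl
    ; orbits  = classIndex-≡⇔ orbit-isDecEquivalence }

  open Schurian orbitIndex-schurian using (orbits)
  open SchurianRing H orbitIndex-schurian using (StabiliserFixes; conjugate; aset∈A⇔stabiliser-fixes-a)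

  Hset-invariant : ∀ {g g′} → g ∼ g′ → Hset H g ≡ Hset H g′
  Hset-invariant {g} {g′} (b , Bb , bε≡ε , bg≡g′) = cong not (sym (begin
    proj₂ g′                    ≡⟨ cong proj₂ bg≡g′ ⟨
    proj₂ (to b g)              ≡⟨ layer-formula connected ¬bipartite (to b) (λ u v → ⇒ (Bb u v)) g e ⟩
    proj₂ g xor proj₂ (to b ε)  ≡⟨ cong (λ h → proj₂ g xor proj₂ h) bε≡ε ⟩
    proj₂ g xor false           ≡⟨ xor-identityʳ _ ⟩
    proj₂ g                     ∎))
    where open ≡-Reasoning

  Sa-invariant : ∀ {g g′} → g ∼ g′ → Sa H S g ≡ Sa H S g′
  Sa-invariant {g} {g′} (b , Bb , bε≡ε , bg≡g′) = ≡true-injective (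
    ε-adj⇔Sa g′ ⇔-∘ (subst₂ (λ u v → Adj Γ₂ ε g ⇔ Adj Γ₂ u v) bε≡ε bg≡g′ (Bb ε g)
                 ⇔-∘ ⇔-sym (ε-adj⇔Sa g)))

  Hset∈A : InA H orbitIndex (Hset H)
  Hset∈A g g′ = Hset-invariant ∘ ⇒ (orbits g g′)

  Sa∈A : InA H orbitIndex (Sa H S)
  Sa∈A g g′ = Sa-invariant ∘ ⇒ (orbits g g′)

  -- z ↦ F (z ∙ p) // F p lies in the stabiliser of ε, so it fixes a.
  a-central : StabiliserFixes (a H) → ∀ (F : Aut Γ₂) p → to (perm F) (a H ∙ p) ≡ a H ∙ to (perm F) p
  a-central fixes F p with conjugate (perm F) (pres F) p
  ... | d , Bd , dε≡ε , d≗ = begin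
    F′ (a H ∙ p)                   ≡⟨ //-rightDividesˡ (F′ p) _ ⟨
    (F′ (a H ∙ p) // F′ p) ∙ F′ p  ≡⟨ cong (_∙ F′ p) (d≗ (a H)) ⟨
    to d (a H) ∙ F′ p              ≡⟨ cong (_∙ F′ p) (fixes d Bd dε≡ε) ⟩
    a H ∙ F′ p                     ∎
    where
    open ≡-Reasoning
    F′ = to (perm F)

  stabiliser-fixes-a⇒IsLift : StabiliserFixes (a H) → ∀ F → IsLift e F
  stabiliser-fixes-a⇒IsLift fixes F x β =
    cong₂ _,_ (base-component β) (layer-formula connected ¬bipartite F′ (λ u v → ⇒ (pres F u v)) (x , β) e)
    where
    open ≡-Reasoning
    F′ = to (perm F)
    base-component : ∀ β → proj₁ (F′ (x , β)) ≡ base e F x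
    base-component false = refl
    base-component true  = begin
      proj₁ (F′ (x , true))          ≡⟨ cong (λ y → proj₁ (F′ (y , true))) (idˡ x) ⟨
      proj₁ (F′ (a H ∙ (x , false))) ≡⟨ cong proj₁ (a-central fixes F (x , false)) ⟩
      e · base e F x                 ≡⟨ idˡ _ ⟩
      base e F x                     ∎

  unstable⇒aset∉A : Unstable (Cay H S) → ¬ InA H orbitIndex (aset H)
  unstable⇒aset∉A unstable aset∈A =
    unstable (every-IsLift⇒stable e (stabiliser-fixes-a⇒IsLift (⇒ aset∈A⇔stabiliser-fixes-a aset∈A)))

theorem1p1 : (n : ℕ) (H : FinGroup n) (S : Fin n → Bool) →
    S (FinGroup.e H) ≡ false →
    (∀ x → S (FinGroup.inv H x) ≡ S x) →
    Connected (Cay H S) →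
    ¬ Bipartite (Cay H S) →
    Unstable (Cay H S) ⇔
      (∃[ κ ] (IsSRing H κ × Schurian H κ × InA H κ (Hset H) × InA H κ (Sa H S) × ¬ InA H κ (aset H)))
theorem1p1 n H S _ _ connected ¬bipartite = mk⇔
  (λ unstable → orbitIndex H S connected ¬bipartite ,
     SchurianRing.isSRing H (orbitIndex-schurian H S connected ¬bipartite) ,
     orbitIndex-schurian H S connected ¬bipartite ,
     Hset∈A H S connected ¬bipartite , Sa∈A H S connected ¬bipartite ,
     unstable⇒aset∉A H S connected ¬bipartite unstable)
  (λ (_ , _ , schurian , _ , Sa∈A , aset∉A) → schurian⇒unstable H S schurian Sa∈A aset∉A)
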